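{- Let $m\ge 0$ be an integer, and let $\lambda$ be a partition with $m$-Durfee rectangle symbol $(\alpha,\beta)_{(m+j)\times j}$. Then $m-1$ belongs to the rank-set of $\lambda$ if and only if $\alpha_1\le m+j-1$.
   Context: For a partition $\lambda=(\lambda_1\ge\cdots\ge\lambda_{\ell(\lambda)}\ge1)$, set $\lambda_k=0$ for $k>\ell(\lambda)$. The rank-set of $\lambda$ is $\{i-\lambda_{i+1}: i\ge 0\}$. The conjugate $\lambda'$ is given by $\lambda'_i=\#\{r:\lambda_r\ge i\}$. $m$-Durfee rectangle symbol. If $\ell(\lambda)\ge m+1$, let $$j=\max\{k: 1\le k\le \ell(\lambda),\ \lambda_{k+m}\ge k\};$$ if $\ell(\lambda)\le m$, let $j=0$. The $(m+j)\times j$ rectangle is the $m$-Durfee rectangle. Then $$\alpha=(\lambda_1-j,\lambda_2-j,\ldots,\lambda_{m+j}-j)',$$ the conjugate of the partition formed by the positive entries, and $$\beta=(\lambda_{m+j+1},\ldots,\lambda_{\ell(\lambda)}).$$ For example, when $j=0$ we have $\alpha=\lambda'$ and $\beta=\emptyset$. By convention $\alpha_i=0$ for $i>\ell(\alpha)$, so $\alpha_1=0$ if $\alpha$ is empty. -}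

module Defs where

open import Data.Nat using (ℕ; zero; suc; _+_; _∸_; _≤_; _≥_; _≤?_; _<?_)
open import Data.List using (List; []; _∷_; length; map; filter; drop; take)
open import Data.List.Relation.Unary.All using (All)
open import Data.List.Relation.Unary.Linked using (Linked)
open import Data.Integer using (ℤ; +_; _-_)
open import Data.Product using (∃; _×_)
open import Relation.Nullary.Decidable using (does)
open import Data.Bool using (if_then_else_)
open import Relation.Binary.PropositionalEquality using (_≡_)

IsPartition : List ℕ → Set
IsPartition λs = Linked (λ a b → b ≤ a) λs × All (1 ≤_) λs

len : List ℕ → ℕ
len = length

at : List ℕ → ℕ → ℕ
at []       _       = 0
at (x ∷ xs) zero    = x
at (x ∷ xs) (suc n) = at xs n

-- 1-based part λ_k, with λ_k = 0 for k > ℓ(λ) (and λ_0 unused)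
part : List ℕ → ℕ → ℕ
part λs k = at λs (k ∸ 1)

InRankSet : ℤ → List ℕ → Set
InRankSet r λs = ∃ λ (i : ℕ) → (+ i) - (+ part λs (suc i)) ≡ r

conj : List ℕ → ℕ → ℕ
conj μ i = length (filter (λ x → i ≤? x) μ)

-- largest k with 1 ≤ k ≤ n and λ_{k+m} ≥ k, or 0 if none
jAux : List ℕ → ℕ → ℕ → ℕ
jAux λs m zero    = 0
jAux λs m (suc n) =
  if does (suc n ≤? part λs (suc n + m)) then suc n else jAux λs m n

durfeeJ : ℕ → List ℕ → ℕ
durfeeJ m λs = if does (m <? len λs) then jAux λs m (len λs) else 0

-- (λ₁ - j, …, λ_{m+j} - j) (truncated list; zero entries do not affect the conjugate)
alphaPre : ℕ → List ℕ → List ℕ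
alphaPre m λs = map (λ x → x ∸ durfeeJ m λs) (take (m + durfeeJ m λs) λs)

-- α = conjugate of the positive entries of alphaPre; α_i (i ≥ 1), 0 beyond ℓ(α)
alpha : ℕ → List ℕ → ℕ → ℕ
alpha m λs i = conj (filter (λ x → 1 ≤? x) (alphaPre m λs)) i

beta : ℕ → List ℕ → List ℕ
beta m λs = drop (m + durfeeJ m λs) λs

-- Write λᵢ₊₁ = at λs i. The rank condition m - 1 = i - λᵢ₊₁ says i + 1 = m + λᵢ₊₁. The Durfee
-- parameter j satisfies λ_{m+j} ≥ j and λ_{m+j+1} ≤ j, and since λ decreases, a solution i can only
-- be the last row of the rectangle: i + 1 = m + j with λ_{m+j} = j. On the other side, α₁ counts the
-- rows k ≤ m + j with λ_k > j; since λ decreases it falls short of m + j exactly when λ_{m+j} ≤ j,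
-- which together with λ_{m+j} ≥ j is again λ_{m+j} = j.
module Submission where

open import Defs
open import Data.Nat as ℕ using (ℕ; zero; suc; pred; _+_; _∸_; _≥_; _≤?_; _<?_; z≤n; s≤s)
open import Data.Nat.Properties
open import Data.Integer as ℤ using (+_; _-_; _≤_)
import Data.Integer.Properties as ℤ
open import Data.Integer.Tactic.RingSolver using (solve)
open import Data.List using (List; []; _∷_; length; map; filter; take)
open import Data.List.Properties using (filter-idem; filter-accept; filter-reject)
open import Data.List.Relation.Unary.Linked as Linked using (Linked)
open import Data.Product using (∃; _×_; _,_)
open import Data.Bool using (true; false)
open import Data.Empty using (⊥; ⊥-elim)
open import Relation.Nullary using (yes; no)
open import Relation.Nullary.Reflects using (ofʸ; ofⁿ)
open import Relation.Binary.PropositionalEquality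
open import Function.Bundles using (_⇔_; Equivalence; mk⇔)
import Function.Properties.Equivalence as ⇔

at-beyond : ∀ xs {i} → length xs ℕ.≤ i → at xs i ≡ 0
at-beyond []       _       = refl
at-beyond (x ∷ xs) (s≤s p) = at-beyond xs p

at-≤-head : ∀ {x xs} → Linked _≥_ (x ∷ xs) → ∀ k → at (x ∷ xs) k ℕ.≤ x
at-≤-head                 _   zero    = ≤-refl
at-≤-head {xs = []}       _   (suc k) = z≤n
at-≤-head {xs = _ ∷ _}    dec (suc k) = ≤-trans (at-≤-head (Linked.tail dec) k) (Linked.head dec)

at-antitone : ∀ {xs} → Linked _≥_ xs → ∀ {i k} → i ℕ.≤ k → at xs k ℕ.≤ at xs i
at-antitone {[]}    _   _             = z≤n
at-antitone {_ ∷ _} dec {k = k} z≤n   = at-≤-head dec k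
at-antitone {_ ∷ _} dec (s≤s i≤k)     = at-antitone (Linked.tail dec) i≤k

-- `jAux` and `durfeeJ` branch on `does (_ ≤? _)`, which computes to `_<ᵇ_`; `<ᵇ-reflects-<` recovers the proof.
jAux-fits : ∀ L m n {r} → jAux L m n ≡ suc r → suc r ℕ.≤ at L (r + m)
jAux-fits L m (suc n) eq with n ℕ.<ᵇ at L (n + m) | <ᵇ-reflects-< n (at L (n + m))
jAux-fits L m (suc n) refl | true | ofʸ fits = fits
... | false | _ = jAux-fits L m n eq

jAux-maximal : ∀ L m n {k} → jAux L m n ℕ.≤ k → k ℕ.< n → at L (k + m) ℕ.≤ k
jAux-maximal L m (suc n) {k} j≤k k<n with n ℕ.<ᵇ at L (n + m) | <ᵇ-reflects-< n (at L (n + m))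
... | true  | _ = ⊥-elim (<⇒≱ k<n j≤k)
... | false | ofⁿ unfit with k ℕ.≟ n
...   | yes refl = ≤-pred (≰⇒> unfit)
...   | no k≢n   = jAux-maximal L m n j≤k (≤∧≢⇒< (≤-pred k<n) k≢n)

durfeeJ-fits : ∀ m L {r} → durfeeJ m L ≡ suc r → suc r ℕ.≤ at L (r + m)
durfeeJ-fits m L eq with m ℕ.<ᵇ len L
... | true = jAux-fits L m (len L) eq

durfeeJ-maximal : ∀ m L → at L (durfeeJ m L + m) ℕ.≤ durfeeJ m L
durfeeJ-maximal m L with m ℕ.<ᵇ len L | <ᵇ-reflects-< m (len L)
... | false | ofⁿ short = ≤-reflexive (at-beyond L (≮⇒≥ short))
... | true  | _ with jAux L m (len L) <? len L
...   | yes j<ℓ = jAux-maximal L m (len L) ≤-refl j<ℓ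
...   | no j≮ℓ  = ≤-trans (≤-reflexive (at-beyond L (≤-trans (≮⇒≥ j≮ℓ) (m≤m+n _ m)))) z≤n

durfeeJ-≤-corner : ∀ m L → durfeeJ m L ℕ.≤ at L (pred (m + durfeeJ m L))
durfeeJ-≤-corner m L with durfeeJ m L in eqJ
... | zero  = z≤n
... | suc r = subst (λ k → suc r ℕ.≤ at L k) r+m≡pred (durfeeJ-fits m L eqJ)
  where
  r+m≡pred : r + m ≡ pred (m + suc r)
  r+m≡pred = trans (+-comm r m) (cong pred (sym (+-suc m r)))

row-height-≡-durfeeJ : ∀ m {L} → Linked _≥_ L → ∀ {i} → suc i ≡ m + at L i → at L i ≡ durfeeJ m L
row-height-≡-durfeeJ m {L} dec {i} eq = ≤-antisym (≮⇒≥ above) (≮⇒≥ below)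
  where
  open ≤-Reasoning
  j : ℕ
  j = durfeeJ m L
  above : j ℕ.< at L i → ⊥
  above j<a = <⇒≱ j<a (begin
    at L i       ≤⟨ at-antitone dec j+m≤i ⟩
    at L (j + m) ≤⟨ durfeeJ-maximal m L ⟩
    j            ∎)
    where
    j+m≤i : j + m ℕ.≤ i
    j+m≤i = ≤-pred (subst (j + m ℕ.<_) (trans (+-comm _ m) (sym eq)) (+-monoˡ-< m j<a))
  below : at L i ℕ.< j → ⊥
  below a<j = <⇒≱ a<j (begin
    j                      ≤⟨ durfeeJ-≤-corner m L ⟩
    at L (pred (m + j))    ≤⟨ at-antitone dec i≤pred ⟩
    at L i                 ∎)
    where
    i≤pred : i ℕ.≤ pred (m + j)
    i≤pred = <⇒≤ (<⇒≤pred (subst (ℕ._< m + j) (sym eq) (+-monoʳ-< m a<j)))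

positives : List ℕ → ℕ
positives xs = length (filter (1 ≤?_) xs)

alpha-one : ∀ m L → alpha m L 1 ≡ positives (alphaPre m L)
alpha-one m L = cong length (filter-idem (1 ≤?_) (alphaPre m L))

positives-take-≤ : ∀ xs i {j} → at xs i ℕ.≤ j → positives (map (_∸ j) (take (suc i) xs)) ℕ.≤ i
positives-take-≤ []       _       _   = z≤n
positives-take-≤ (x ∷ xs) zero    {j} x≤j rewrite m≤n⇒m∸n≡0 x≤j = z≤n
positives-take-≤ (x ∷ xs) (suc i) {j} ≤j with 1 ≤? x ∸ j
... | yes pos = ≤-trans (≤-reflexive (cong length (filter-accept (1 ≤?_) pos))) (s≤s (positives-take-≤ xs i ≤j))
... | no ¬pos = ≤-trans (≤-reflexive (cong length (filter-reject (1 ≤?_) ¬pos))) (m≤n⇒m≤1+n (positives-take-≤ xs i ≤j))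

positives-take-≡ : ∀ {xs} → Linked _≥_ xs → ∀ i {j} → j ℕ.< at xs i → positives (map (_∸ j) (take (suc i) xs)) ≡ suc i
positives-take-≡ {[]}     _   _ ()
positives-take-≡ {x ∷ xs} dec i {j} j<at = begin
  positives (x ∸ j ∷ map (_∸ j) (take i xs))     ≡⟨ cong length (filter-accept (1 ≤?_) (m<n⇒0<n∸m j<x)) ⟩
  suc (positives (map (_∸ j) (take i xs)))      ≡⟨ cong suc (rest i j<at) ⟩
  suc i                                         ∎
  where
  open ≡-Reasoning
  j<x : j ℕ.< x
  j<x = ≤-trans j<at (at-≤-head dec i)
  rest : ∀ i → j ℕ.< at (x ∷ xs) i → positives (map (_∸ j) (take i xs)) ≡ i
  rest zero    _     = refl
  rest (suc i) j<at′ = positives-take-≡ (Linked.tail dec) i j<at′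

positives-take-bound⇔ : ∀ {L} → Linked _≥_ L → ∀ n j →
  (+ positives (map (_∸ j) (take n L)) ≤ + n - + 1) ⇔ ∃ λ i → n ≡ suc i × at L i ℕ.≤ j
positives-take-bound⇔ dec zero    j = mk⇔ (λ ()) (λ ())
positives-take-bound⇔ {L} dec (suc i) j = mk⇔ to from
  where
  to : + positives (map (_∸ j) (take (suc i) L)) ≤ + i → ∃ λ i′ → suc i ≡ suc i′ × at L i′ ℕ.≤ j
  to (ℤ.+≤+ p≤i) with at L i ≤? j
  ... | yes a≤j = i , refl , a≤j
  ... | no a≰j  = ⊥-elim (1+n≰n (subst (ℕ._≤ i) (positives-take-≡ dec i (≰⇒> a≰j)) p≤i))
  from : ∃ (λ i′ → suc i ≡ suc i′ × at L i′ ℕ.≤ j) → + positives (map (_∸ j) (take (suc i) L)) ≤ + i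
  from (_ , refl , a≤j) = ℤ.+≤+ (positives-take-≤ L i a≤j)

alpha-bound⇔ : ∀ m {L} → Linked _≥_ L →
  (+ alpha m L 1 ≤ + (m + durfeeJ m L) - + 1) ⇔ ∃ λ i → m + durfeeJ m L ≡ suc i × at L i ℕ.≤ durfeeJ m L
alpha-bound⇔ m {L} dec rewrite alpha-one m L =
  positives-take-bound⇔ dec (m + durfeeJ m L) (durfeeJ m L)

x-y≡z-w⇔w+x≡z+y : ∀ x y z w → x - y ≡ z - w ⇔ w ℤ.+ x ≡ z ℤ.+ y
x-y≡z-w⇔w+x≡z+y x y z w = mk⇔ to from
  where
  open ≡-Reasoning
  to : x - y ≡ z - w → w ℤ.+ x ≡ z ℤ.+ y
  to e = begin
    w ℤ.+ x                ≡⟨ solve (x ∷ y ∷ w ∷ []) ⟩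
    (x - y) ℤ.+ (y ℤ.+ w)  ≡⟨ cong (ℤ._+ (y ℤ.+ w)) e ⟩
    (z - w) ℤ.+ (y ℤ.+ w)  ≡⟨ solve (z ∷ y ∷ w ∷ []) ⟩
    z ℤ.+ y                ∎
  from : w ℤ.+ x ≡ z ℤ.+ y → x - y ≡ z - w
  from e = begin
    x - y                  ≡⟨ solve (x ∷ y ∷ w ∷ []) ⟩
    (w ℤ.+ x) - (y ℤ.+ w)  ≡⟨ cong (_- (y ℤ.+ w)) e ⟩
    (z ℤ.+ y) - (y ℤ.+ w)  ≡⟨ solve (z ∷ y ∷ w ∷ []) ⟩
    z - w                  ∎

inRankSet-pred⇔ : ∀ m L → InRankSet (+ m - + 1) L ⇔ ∃ λ i → suc i ≡ m + at L i
inRankSet-pred⇔ m L = mk⇔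
  (λ (i , e) → i , ℤ.+-injective (Equivalence.to (x-y≡z-w⇔w+x≡z+y (+ i) (+ at L i) (+ m) (+ 1)) e))
  (λ (i , e) → i , Equivalence.from (x-y≡z-w⇔w+x≡z+y (+ i) (+ at L i) (+ m) (+ 1)) (cong +_ e))

rank-row⇔corner-row : ∀ m {L} → Linked _≥_ L →
  (∃ λ i → suc i ≡ m + at L i) ⇔ (∃ λ i → m + durfeeJ m L ≡ suc i × at L i ℕ.≤ durfeeJ m L)
rank-row⇔corner-row m {L} dec = mk⇔ to from
  where
  j : ℕ
  j = durfeeJ m L
  to : (∃ λ i → suc i ≡ m + at L i) → ∃ λ i → m + j ≡ suc i × at L i ℕ.≤ j
  to (i , eq) = i , trans (cong (m ℕ.+_) (sym a≡j)) (sym eq) , ≤-reflexive a≡j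
    where
    a≡j : at L i ≡ j
    a≡j = row-height-≡-durfeeJ m dec eq
  from : (∃ λ i → m + j ≡ suc i × at L i ℕ.≤ j) → ∃ λ i → suc i ≡ m + at L i
  from (i , eq , a≤j) = i , trans (sym eq) (cong (m ℕ.+_) (≤-antisym j≤a a≤j))
    where
    j≤a : j ℕ.≤ at L i
    j≤a = subst (λ k → j ℕ.≤ at L k) (cong pred eq) (durfeeJ-≤-corner m L)

lemma2p2 : (m : ℕ) (λs : List ℕ) → IsPartition λs →
    InRankSet ((+ m) - (+ 1)) λs ⇔ ((+ alpha m λs 1) ≤ (+ (m + durfeeJ m λs)) - (+ 1))
lemma2p2 m λs (decreasing , _) =
  ⇔.trans (inRankSet-pred⇔ m λs)
    (⇔.trans (rank-row⇔corner-row m decreasing) (⇔.sym (alpha-bound⇔ m decreasing)))
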